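{- Let $G$ be a finite group. If $m$ is a positive integer and $X_I\in\mathcal{E}_m$, then $X_I$ has an option in $\mathcal{E}_{m-1}$ and every option of $X_I$ is in either $\mathcal{E}_m$ or $\mathcal{E}_{m-1}$.
   Context: The positions of $\text{GEN}(G)$ are the non-generating subsets of $G$ (nonterminal) and the generating sets $S$ having some $g\in S$ with $\langle S\setminus\{g\}\rangle\ne G$ (terminal). Let $\mathcal{M}$ be the set of maximal subgroups of $G$ and $\mathcal{I}=\{\cap\mathcal{N}:\emptyset\neq\mathcal{N}\subseteq\mathcal{M}\}$. For $I\in\mathcal{I}$, $X_I$ is the set of subsets of $I$ not contained in any $J\in\mathcal{I}$ with $J\subsetneq I$; $X_G$ is the set of terminal positions. For $I\in\mathcal{I}$ and $K\in\mathcal{I}\cup\{G\}$, $X_K$ is an option of $X_I$ if $I\cup\{g\}\in X_K$ for some $g\in G\setminus I$. The deficiency $\delta(P)$ of $P\subseteq G$ is the minimum size of $Q\subseteq G$ with $\langle P\cup Q\rangle=G$; $\delta(X_I):=\delta(I)$. $X_I$ is even if $|I|$ is even. $\mathcal{E}_m$ is the set of even structure classes $X_I$, $I\in\mathcal{I}\cup\{G\}$, with $\delta(X_I)=m$. -}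

module Defs where

open import Data.Nat using (ℕ; suc; _≤_)
open import Data.Nat.Divisibility using (_∣_)
open import Data.Fin using (Fin)
open import Data.Fin.Subset
  using (Subset; _∈_; _∉_; _⊆_; _⊂_; _∪_; ⁅_⁆; ⊤; ⋂; ∣_∣; _-_)
open import Data.List using (List; _∷_)
open import Data.List.Relation.Unary.All using (All)
open import Data.Product using (Σ; ∃; _×_)
open import Data.Sum using (_⊎_)
open import Relation.Nullary using (¬_)
open import Relation.Binary.PropositionalEquality using (_≡_; _≢_)

-- A finite group, presented (up to isomorphism) on the carrier Fin n,
-- with propositional equality.
record FiniteGroup : Set where
  field
    n     : ℕ
    _·_   : Fin n → Fin n → Fin n
    e     : Fin n
    inv   : Fin n → Fin n
    assoc : ∀ x y z → (x · y) · z ≡ x · (y · z)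
    idˡ   : ∀ x → e · x ≡ x
    idʳ   : ∀ x → x · e ≡ x
    invˡ  : ∀ x → inv x · x ≡ e
    invʳ  : ∀ x → x · inv x ≡ e

module _ (G : FiniteGroup) where
  open FiniteGroup G

  IsSubgroup : Subset n → Set
  IsSubgroup H = (e ∈ H)
               × (∀ x y → x ∈ H → y ∈ H → (x · y) ∈ H)
               × (∀ x → x ∈ H → inv x ∈ H)

  _∈⟨_⟩ : Fin n → Subset n → Set
  g ∈⟨ S ⟩ = ∀ H → IsSubgroup H → S ⊆ H → g ∈ H

  Generates : Subset n → Set
  Generates S = ∀ g → g ∈⟨ S ⟩

  IsMaximal : Subset n → Set
  IsMaximal M = IsSubgroup M × M ≢ ⊤
              × (∀ H → IsSubgroup H → M ⊆ H → H ≡ M ⊎ H ≡ ⊤)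

  -- 𝓘 : intersections of nonempty families of maximal subgroups
  InI : Subset n → Set
  InI I = Σ (Subset n) λ M → Σ (List (Subset n)) λ Ms →
            All IsMaximal (M ∷ Ms) × I ≡ ⋂ (M ∷ Ms)

  InIG : Subset n → Set
  InIG K = InI K ⊎ K ≡ ⊤

  -- terminal positions of GEN(G)
  Terminal : Subset n → Set
  Terminal S = Generates S × Σ (Fin n) λ g → g ∈ S × ¬ Generates (S - g)

  InX : Subset n → Subset n → Set
  InX K P = (InI K × P ⊆ K × (∀ J → InI J → J ⊂ K → ¬ (P ⊆ J)))
          ⊎ (K ≡ ⊤ × Terminal P)

  Option : Subset n → Subset n → Set
  Option I K = Σ (Fin n) λ g → g ∉ I × InX K (I ∪ ⁅ g ⁆)

  Deficiency : Subset n → ℕ → Set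
  Deficiency P d = (Σ (Subset n) λ Q → ∣ Q ∣ ≡ d × Generates (P ∪ Q))
                 × (∀ Q → Generates (P ∪ Q) → d ≤ ∣ Q ∣)

  InE : ℕ → Subset n → Set
  InE m K = InIG K × 2 ∣ ∣ K ∣ × Deficiency K m

-- Since δ(I) > 0, I is a proper intersection of maximal subgroups. Every option X_K of X_I comes
-- from a set P = I ∪ {g}, and K lies between P and every maximal subgroup containing P; hence
-- P ∪ Q and K ∪ Q generate G for the same sets Q, so δ(K) = δ(P) ∈ {δ(I), δ(I) − 1}. Taking g
-- from a smallest set completing I to a generating set gives δ(P) = δ(I) − 1. Finally K is a
-- subgroup containing I. Inversion pairs off the elements of I ∖ {e}, so as |I| is even some
-- t ≠ e in I satisfies t t = e; then x ↦ x t pairs off the elements of K, and |K| is even.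
module Submission where

open import Defs
open import Data.Empty using (⊥-elim)
open import Data.Fin using (Fin; zero; suc)
open import Data.Fin.Properties using (any?; all?) renaming (_≟_ to _≟ᶠ_)
open import Data.Fin.Subset
open import Data.Fin.Subset.Properties
open import Data.Fin.Subset.Induction using (⊂-wellFounded; ⊃-wellFounded)
open import Data.Bool.Properties using () renaming (_≟_ to _≟ᵇ_)
open import Data.List using ([]; _∷_)
open import Data.List.Relation.Unary.All as All using (All; []; _∷_)
open import Data.Nat using (ℕ; suc; _+_; _≤_; s≤s; _≤?_)
open import Data.Nat.Divisibility using (_∣_; _∣0; ∣-refl; ∣m∣n⇒∣m+n; ∣m+n∣m⇒∣n; ∣1⇒≡1)
open import Data.Nat.Properties
  using (≤-refl; ≤-trans; ≤-reflexive; ≤-antisym; n≤1+n; ≰⇒>; 0≢1+n; suc-injective; <-irrefl; +-comm)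
open import Data.Product
open import Data.Sum as Sum using (_⊎_; inj₁; inj₂; [_,_])
open import Data.Vec using (_∷_; here; there)
open import Data.Vec.Properties using (≡-dec)
open import Function using (id; _∘_)
open import Induction.WellFounded using (Acc; acc)
open import Relation.Nullary
open import Relation.Unary using (Decidable)
open import Relation.Binary.PropositionalEquality hiding ([_])

private variable
  n : ℕ

x∈p─q⇒x∉q : ∀ (p q : Subset n) {x} → x ∈ p ─ q → x ∉ q
x∈p─q⇒x∉q (s ∷ p) (inside  ∷ q) () here
x∈p─q⇒x∉q (s ∷ p) (outside ∷ q) {zero} x∈p─q ()
x∈p─q⇒x∉q (s ∷ p) (t ∷ q) (there x∈p─q) (there x∈q) = x∈p─q⇒x∉q p q x∈p─q x∈q

x∈p-y⇒x∈p×x≢y : ∀ (p : Subset n) {x y} → x ∈ p - y → x ∈ p × x ≢ y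
x∈p-y⇒x∈p×x≢y p {y = y} x∈p-y =
  p─q⊆p p ⁅ y ⁆ x∈p-y , x∉⁅y⁆⇒x≢y (x∈p─q⇒x∉q p ⁅ y ⁆ x∈p-y)

∪-lub : ∀ {p q r : Subset n} → p ⊆ r → q ⊆ r → p ∪ q ⊆ r
∪-lub {p = p} {q} p⊆r q⊆r x∈p∪q = [ p⊆r , q⊆r ] (x∈p∪q⁻ p q x∈p∪q)

∪-monoˡ-⊆ : ∀ {p q : Subset n} r → p ⊆ q → p ∪ r ⊆ q ∪ r
∪-monoˡ-⊆ {q = q} r p⊆q = ∪-lub (p⊆p∪q r ∘ p⊆q) (q⊆p∪q q r)

⊆-⋂⁺ : ∀ {p : Subset n} qs → All (p ⊆_) qs → p ⊆ ⋂ qs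
⊆-⋂⁺ []       []           _   = ∈⊤
⊆-⋂⁺ (q ∷ qs) (p⊆q ∷ p⊆qs) x∈p = x∈p∩q⁺ (p⊆q x∈p , ⊆-⋂⁺ qs p⊆qs x∈p)

⊆-⋂⁻ : ∀ {p : Subset n} qs → p ⊆ ⋂ qs → All (p ⊆_) qs
⊆-⋂⁻ []       _      = []
⊆-⋂⁻ (q ∷ qs) p⊆⋂qs =
  (proj₁ ∘ x∈p∩q⁻ q (⋂ qs) ∘ p⊆⋂qs) ∷ ⊆-⋂⁻ qs (proj₂ ∘ x∈p∩q⁻ q (⋂ qs) ∘ p⊆⋂qs)

p⊈q⇒∃ : ∀ {p q : Subset n} → ¬ p ⊆ q → ∃ λ x → x ∈ p × x ∉ q
p⊈q⇒∃ {p = p} {q} p⊈q with any? (λ x → x ∈? p ×-dec ¬? (x ∈? q))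
... | yes witness = witness
... | no ¬witness = ⊥-elim (p⊈q p⊆q)
  where
  p⊆q : p ⊆ q
  p⊆q {x} x∈p = decidable-stable (x ∈? q) (λ x∉q → ¬witness (x , x∈p , x∉q))

p⊈q⇒q∩p⊂p : ∀ {p q : Subset n} → ¬ p ⊆ q → q ∩ p ⊂ p
p⊈q⇒q∩p⊂p {p = p} {q} p⊈q with p⊈q⇒∃ p⊈q
... | x , x∈p , x∉q = p∩q⊆q q p , x , x∈p , x∉q ∘ proj₁ ∘ x∈p∩q⁻ q p

∣p-x∣+1≡∣p∣ : ∀ (p : Subset n) {x} → x ∈ p → suc ∣ p - x ∣ ≡ ∣ p ∣
∣p-x∣+1≡∣p∣ (inside  ∷ p) here       = cong (suc ∘ ∣_∣) (p─⊥≡p p)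
∣p-x∣+1≡∣p∣ (inside  ∷ p) (there x∈p) = cong suc (∣p-x∣+1≡∣p∣ p x∈p)
∣p-x∣+1≡∣p∣ (outside ∷ p) (there x∈p) = ∣p-x∣+1≡∣p∣ p x∈p

∣p∪⁅x⁆∣≤1+∣p∣ : ∀ (p : Subset n) x → ∣ p ∪ ⁅ x ⁆ ∣ ≤ suc ∣ p ∣
∣p∪⁅x⁆∣≤1+∣p∣ (inside  ∷ p) zero    rewrite ∪-identityʳ p = s≤s (n≤1+n _)
∣p∪⁅x⁆∣≤1+∣p∣ (outside ∷ p) zero    rewrite ∪-identityʳ p = ≤-refl
∣p∪⁅x⁆∣≤1+∣p∣ (inside  ∷ p) (suc x) = s≤s (∣p∪⁅x⁆∣≤1+∣p∣ p x)
∣p∪⁅x⁆∣≤1+∣p∣ (outside ∷ p) (suc x) = ∣p∪⁅x⁆∣≤1+∣p∣ p x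

∣p∣≡0⊎Nonempty : ∀ (p : Subset n) → ∣ p ∣ ≡ 0 ⊎ Nonempty p
∣p∣≡0⊎Nonempty {n} p with nonempty? p
... | yes ne = inj₂ ne
... | no ∅   = inj₁ (trans (cong ∣_∣ (Empty-unique ∅)) (∣⊥∣≡0 n))

[p∪⁅x⁆]-x⊆p : ∀ (p : Subset n) {x} → (p ∪ ⁅ x ⁆) - x ⊆ p
[p∪⁅x⁆]-x⊆p p {x} y∈ with x∈p-y⇒x∈p×x≢y (p ∪ ⁅ x ⁆) y∈
... | y∈p∪⁅x⁆ , y≢x = [ id , ⊥-elim ∘ y≢x ∘ x∈⁅y⁆⇒x≡y x ] (x∈p∪q⁻ p ⁅ x ⁆ y∈p∪⁅x⁆)

p∪q⊆[p∪⁅x⁆]∪[q-x] : ∀ (p q : Subset n) x → p ∪ q ⊆ (p ∪ ⁅ x ⁆) ∪ (q - x)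
p∪q⊆[p∪⁅x⁆]∪[q-x] p q x {y} y∈p∪q with x∈p∪q⁻ p q y∈p∪q | y ≟ᶠ x
... | inj₁ y∈p | _        = p⊆p∪q (q - x) (p⊆p∪q ⁅ x ⁆ y∈p)
... | inj₂ _   | yes refl = p⊆p∪q (q - x) (q⊆p∪q p ⁅ x ⁆ (x∈⁅x⁆ x))
... | inj₂ y∈q | no y≢x   = q⊆p∪q (p ∪ ⁅ x ⁆) (q - x) (x∈p∧x≢y⇒x∈p-y y∈q y≢x)

2∣n⇒2∤1+n : ∀ {n} → 2 ∣ n → ¬ 2 ∣ suc n
2∣n⇒2∤1+n {n} 2∣n 2∣1+n with ∣1⇒≡1 (∣m+n∣m⇒∣n (subst (2 ∣_) (+-comm 1 n) 2∣1+n) 2∣n)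
... | ()

module _ {n : ℕ} (f : Fin n → Fin n) (f-involutive : ∀ x → f (f x) ≡ x) where

  fixedPointFree-closed⇒even : ∀ (p : Subset n) → Acc _⊂_ p →
    (∀ {x} → x ∈ p → f x ∈ p) → (∀ {x} → x ∈ p → f x ≢ x) → 2 ∣ ∣ p ∣
  fixedPointFree-closed⇒even p (acc rec) closed free with ∣p∣≡0⊎Nonempty p
  ... | inj₁ ∣p∣≡0 = subst (2 ∣_) (sym ∣p∣≡0) (2 ∣0)
  ... | inj₂ (x , x∈p) =
    subst (2 ∣_) ∣p∣≡2+∣q∣ (∣m∣n⇒∣m+n ∣-refl (fixedPointFree-closed⇒even q (rec q⊂p) q-closed q-free))
    where
    fx∈p-x : f x ∈ p - x
    fx∈p-x = x∈p∧x≢y⇒x∈p-y (closed x∈p) (free x∈p)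
    q : Subset n
    q = p - x - f x
    q⊂p : q ⊂ p
    q⊂p = ⊂-trans (x∈p⇒p-x⊂p fx∈p-x) (x∈p⇒p-x⊂p x∈p)
    ∣p∣≡2+∣q∣ : 2 + ∣ q ∣ ≡ ∣ p ∣
    ∣p∣≡2+∣q∣ = trans (cong suc (∣p-x∣+1≡∣p∣ (p - x) fx∈p-x)) (∣p-x∣+1≡∣p∣ p x∈p)
    ∈q⁻ : ∀ {y} → y ∈ q → y ∈ p × y ≢ x × y ≢ f x
    ∈q⁻ y∈q with x∈p-y⇒x∈p×x≢y (p - x) y∈q
    ... | y∈p-x , y≢fx = proj₁ (x∈p-y⇒x∈p×x≢y p y∈p-x) , proj₂ (x∈p-y⇒x∈p×x≢y p y∈p-x) , y≢fx
    q-closed : ∀ {y} → y ∈ q → f y ∈ q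
    q-closed {y} y∈q with ∈q⁻ y∈q
    ... | y∈p , y≢x , y≢fx = x∈p∧x≢y⇒x∈p-y (x∈p∧x≢y⇒x∈p-y (closed y∈p) fy≢x) fy≢fx
      where
      fy≢x : f y ≢ x
      fy≢x fy≡x = y≢fx (trans (sym (f-involutive y)) (cong f fy≡x))
      fy≢fx : f y ≢ f x
      fy≢fx fy≡fx = y≢x (trans (sym (f-involutive y)) (trans (cong f fy≡fx) (f-involutive x)))
    q-free : ∀ {y} → y ∈ q → f y ≢ y
    q-free = free ∘ proj₁ ∘ ∈q⁻

module _ (G : FiniteGroup) where
  open FiniteGroup G renaming (n to ∣G∣)

  inv-involutive : ∀ x → inv (inv x) ≡ x
  inv-involutive x = begin
    inv (inv x)               ≡⟨ sym (idʳ _) ⟩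
    inv (inv x) · e           ≡⟨ cong (inv (inv x) ·_) (sym (invˡ x)) ⟩
    inv (inv x) · (inv x · x) ≡⟨ sym (assoc _ _ _) ⟩
    (inv (inv x) · inv x) · x ≡⟨ cong (_· x) (invˡ (inv x)) ⟩
    e · x                     ≡⟨ idˡ x ⟩
    x                         ∎
    where open ≡-Reasoning

  inv-e≡e : inv e ≡ e
  inv-e≡e = trans (sym (idʳ (inv e))) (invˡ e)

  x·y≡x⇒y≡e : ∀ x y → x · y ≡ x → y ≡ e
  x·y≡x⇒y≡e x y x·y≡x = begin
    y               ≡⟨ sym (idˡ y) ⟩
    e · y           ≡⟨ cong (_· y) (sym (invˡ x)) ⟩
    (inv x · x) · y ≡⟨ assoc _ _ _ ⟩
    inv x · (x · y) ≡⟨ cong (inv x ·_) x·y≡x ⟩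
    inv x · x       ≡⟨ invˡ x ⟩
    e               ∎
    where open ≡-Reasoning

  even-subgroup-has-involution : ∀ {H} → IsSubgroup G H → 2 ∣ ∣ H ∣ →
    ∃ λ t → t ∈ H × t ≢ e × t · t ≡ e
  even-subgroup-has-involution {H} (e∈H , _ , inv-closed) 2∣∣H∣
    with any? (λ t → t ∈? H ×-dec ¬? (t ≟ᶠ e) ×-dec (t · t ≟ᶠ e))
  ... | yes involution = involution
  ... | no ¬involution =
    ⊥-elim (2∣n⇒2∤1+n 2∣∣H-e∣ (subst (2 ∣_) (sym (∣p-x∣+1≡∣p∣ H e∈H)) 2∣∣H∣))
    where
    closed : ∀ {x} → x ∈ H - e → inv x ∈ H - e
    closed {x} x∈H-e with x∈p-y⇒x∈p×x≢y H x∈H-e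
    ... | x∈H , x≢e = x∈p∧x≢y⇒x∈p-y (inv-closed x x∈H)
      (λ invx≡e → x≢e (trans (sym (inv-involutive x)) (trans (cong inv invx≡e) inv-e≡e)))
    free : ∀ {x} → x ∈ H - e → inv x ≢ x
    free {x} x∈H-e invx≡x with x∈p-y⇒x∈p×x≢y H x∈H-e
    ... | x∈H , x≢e = ¬involution (x , x∈H , x≢e , trans (cong (x ·_) (sym invx≡x)) (invʳ x))
    2∣∣H-e∣ : 2 ∣ ∣ H - e ∣
    2∣∣H-e∣ = fixedPointFree-closed⇒even inv inv-involutive (H - e) (⊂-wellFounded _) closed free

  even-subgroup⇒even-supergroup : ∀ {H K} → IsSubgroup G H → 2 ∣ ∣ H ∣ →
    IsSubgroup G K → H ⊆ K → 2 ∣ ∣ K ∣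
  even-subgroup⇒even-supergroup H≤G 2∣∣H∣ (_ , ·-closed , _) H⊆K
    with even-subgroup-has-involution H≤G 2∣∣H∣
  ... | t , t∈H , t≢e , t·t≡e =
    fixedPointFree-closed⇒even (_· t) ·t-involutive _ (⊂-wellFounded _)
      (λ {x} x∈K → ·-closed x t x∈K (H⊆K t∈H)) (λ {x} _ → t≢e ∘ x·y≡x⇒y≡e x t)
    where
    ·t-involutive : ∀ x → (x · t) · t ≡ x
    ·t-involutive x = trans (assoc x t t) (trans (cong (x ·_) t·t≡e) (idʳ x))

  ⊤-isSubgroup : IsSubgroup G ⊤
  ⊤-isSubgroup = ∈⊤ , (λ _ _ _ _ → ∈⊤) , (λ _ _ → ∈⊤)

  ∩-isSubgroup : ∀ {H K} → IsSubgroup G H → IsSubgroup G K → IsSubgroup G (H ∩ K)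
  ∩-isSubgroup {H} {K} (e∈H , ·-closedH , inv-closedH) (e∈K , ·-closedK , inv-closedK) =
    x∈p∩q⁺ (e∈H , e∈K) ,
    (λ x y x∈H∩K y∈H∩K →
      let x∈H , x∈K = x∈p∩q⁻ H K x∈H∩K ; y∈H , y∈K = x∈p∩q⁻ H K y∈H∩K
      in x∈p∩q⁺ (·-closedH x y x∈H y∈H , ·-closedK x y x∈K y∈K)) ,
    (λ x x∈H∩K →
      let x∈H , x∈K = x∈p∩q⁻ H K x∈H∩K
      in x∈p∩q⁺ (inv-closedH x x∈H , inv-closedK x x∈K))

  ⋂-isSubgroup : ∀ Hs → All (IsSubgroup G) Hs → IsSubgroup G (⋂ Hs)
  ⋂-isSubgroup []       []             = ⊤-isSubgroup
  ⋂-isSubgroup (H ∷ Hs) (H≤G ∷ Hs≤G) = ∩-isSubgroup H≤G (⋂-isSubgroup Hs Hs≤G)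

  InI⇒IsSubgroup : ∀ {I} → InI G I → IsSubgroup G I
  InI⇒IsSubgroup (M , Ms , maximal , refl) = ⋂-isSubgroup (M ∷ Ms) (All.map proj₁ maximal)

  InIG⇒IsSubgroup : ∀ {K} → InIG G K → IsSubgroup G K
  InIG⇒IsSubgroup (inj₁ K∈𝓘) = InI⇒IsSubgroup K∈𝓘
  InIG⇒IsSubgroup (inj₂ refl) = ⊤-isSubgroup

  IsMaximal⇒InI : ∀ {M} → IsMaximal G M → InI G M
  IsMaximal⇒InI {M} maxM = M , [] , maxM ∷ [] , sym (∩-identityʳ M)

  InI-∩ : ∀ {M K} → IsMaximal G M → InI G K → InI G (M ∩ K)
  InI-∩ {M} maxM (M′ , Ms , maximal , refl) = M , M′ ∷ Ms , maxM ∷ maximal , refl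

  Generates-mono : ∀ {S T} → S ⊆ T → Generates G S → Generates G T
  Generates-mono S⊆T genS g H H≤G T⊆H = genS g H H≤G (T⊆H ∘ S⊆T)

  ⊤-generates : Generates G ⊤
  ⊤-generates g H H≤G ⊤⊆H = ⊤⊆H ∈⊤

  ⊆-proper⇒¬Generates : ∀ {S H} → IsSubgroup G H → S ⊆ H → H ≢ ⊤ → ¬ Generates G S
  ⊆-proper⇒¬Generates {H = H} H≤G S⊆H H≢⊤ genS =
    H≢⊤ (⊆-antisym ⊆⊤ (λ {g} _ → genS g H H≤G S⊆H))

  ⊆-maximal⇒¬Generates : ∀ {S M} → IsMaximal G M → S ⊆ M → ¬ Generates G S
  ⊆-maximal⇒¬Generates (M≤G , M≢⊤ , _) S⊆M = ⊆-proper⇒¬Generates M≤G S⊆M M≢⊤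

  InI⇒¬Generates : ∀ {I} → InI G I → ¬ Generates G I
  InI⇒¬Generates (M , Ms , maxM ∷ _ , refl) = ⊆-maximal⇒¬Generates maxM (proj₁ ∘ x∈p∩q⁻ M (⋂ Ms))

  private
    _≟ˢ_ : (A B : Subset ∣G∣) → Dec (A ≡ B)
    _≟ˢ_ = ≡-dec _≟ᵇ_

    ∀-subset? : ∀ {P : Subset ∣G∣ → Set} → Decidable P → Dec (∀ H → P H)
    ∀-subset? {P} P? with anySubset? (¬? ∘ P?)
    ... | yes (H , ¬PH) = no (λ ∀P → ¬PH (∀P H))
    ... | no ¬∃¬P       = yes (λ H → decidable-stable (P? H) (λ ¬PH → ¬∃¬P (H , ¬PH)))

  IsSubgroup? : Decidable (IsSubgroup G)
  IsSubgroup? H = e ∈? H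
    ×-dec all? (λ x → all? (λ y → x ∈? H →-dec y ∈? H →-dec x · y ∈? H))
    ×-dec all? (λ x → x ∈? H →-dec inv x ∈? H)

  IsMaximal? : Decidable (IsMaximal G)
  IsMaximal? M = IsSubgroup? M ×-dec ¬? (M ≟ˢ ⊤)
    ×-dec ∀-subset? (λ H → IsSubgroup? H →-dec M ⊆? H →-dec (H ≟ˢ M ⊎-dec H ≟ˢ ⊤))

  maximal-above : ∀ {H} → Acc _⊃_ H → IsSubgroup G H → H ≢ ⊤ → ∃ λ M → IsMaximal G M × H ⊆ M
  maximal-above {H} (acc rec) H≤G H≢⊤
    with anySubset? (λ H′ → IsSubgroup? H′ ×-dec H ⊂? H′ ×-dec ¬? (H′ ≟ˢ ⊤))
  ... | yes (H′ , H′≤G , H⊂H′ , H′≢⊤) =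
    let M , maxM , H′⊆M = maximal-above (rec H⊂H′) H′≤G H′≢⊤ in M , maxM , H′⊆M ∘ proj₁ H⊂H′
  ... | no ¬larger = H , (H≤G , H≢⊤ , maximality) , id
    where
    maximality : ∀ H′ → IsSubgroup G H′ → H ⊆ H′ → H′ ≡ H ⊎ H′ ≡ ⊤
    maximality H′ H′≤G H⊆H′ with H′ ≟ˢ H | H′ ≟ˢ ⊤
    ... | yes H′≡H | _        = inj₁ H′≡H
    ... | no _     | yes H′≡⊤ = inj₂ H′≡⊤
    ... | no H′≢H  | no H′≢⊤  = ⊥-elim (¬larger (H′ , H′≤G ,
          (H⊆H′ , p⊈q⇒∃ (λ H′⊆H → H′≢H (⊆-antisym H′⊆H H⊆H′))) , H′≢⊤))

  Generates⊎⊆Maximal : ∀ S → Generates G S ⊎ ∃ λ M → IsMaximal G M × S ⊆ M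
  Generates⊎⊆Maximal S
    with anySubset? (λ H → IsSubgroup? H ×-dec S ⊆? H ×-dec ¬? (H ≟ˢ ⊤))
  ... | yes (H , H≤G , S⊆H , H≢⊤) =
    let M , maxM , H⊆M = maximal-above (⊃-wellFounded H) H≤G H≢⊤ in inj₂ (M , maxM , H⊆M ∘ S⊆H)
  ... | no ¬proper = inj₁ λ g H H≤G S⊆H →
    decidable-stable (g ∈? H) (λ g∉H → ¬proper (H , H≤G , S⊆H , λ { refl → g∉H ∈⊤ }))

  Generates? : Decidable (Generates G)
  Generates? S with Generates⊎⊆Maximal S
  ... | inj₁ genS               = yes genS
  ... | inj₂ (M , maxM , S⊆M) = no (⊆-maximal⇒¬Generates maxM S⊆M)

  -- For K ∈ 𝓘 ∪ {G} this says that K is the intersection of the maximal subgroups containing P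
  -- (G when there are none).
  IsHull : Subset ∣G∣ → Subset ∣G∣ → Set
  IsHull P K = P ⊆ K × (∀ M → IsMaximal G M → P ⊆ M → K ⊆ M)

  hull-generates : ∀ {P K} → IsHull P K → ∀ Q → Generates G (K ∪ Q) → Generates G (P ∪ Q)
  hull-generates {P} {K} (_ , K⊆maximals) Q genK∪Q with Generates⊎⊆Maximal (P ∪ Q)
  ... | inj₁ genP∪Q = genP∪Q
  ... | inj₂ (M , maxM , P∪Q⊆M) = ⊥-elim (⊆-maximal⇒¬Generates maxM K∪Q⊆M genK∪Q)
    where
    K∪Q⊆M : K ∪ Q ⊆ M
    K∪Q⊆M = ∪-lub (K⊆maximals M maxM (P∪Q⊆M ∘ p⊆p∪q Q)) (P∪Q⊆M ∘ q⊆p∪q P Q)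

  hull-deficiency : ∀ {P K d} → IsHull P K → Deficiency G P d → Deficiency G K d
  hull-deficiency hull@(P⊆K , _) ((Q , ∣Q∣≡d , genP∪Q) , minimal) =
    (Q , ∣Q∣≡d , Generates-mono (∪-monoˡ-⊆ Q P⊆K) genP∪Q) ,
    (λ Q′ genK∪Q′ → minimal Q′ (hull-generates hull Q′ genK∪Q′))

  IsHull⇒minimal : ∀ {P K} → IsHull P K → ∀ J → InI G J → J ⊂ K → ¬ P ⊆ J
  IsHull⇒minimal {P} {K} (_ , K⊆maximals) J (M , Ms , maximal , refl) (_ , x , x∈K , x∉J) P⊆J =
    x∉J (⊆-⋂⁺ (M ∷ Ms) (K⊆all maximal (⊆-⋂⁻ (M ∷ Ms) P⊆J)) x∈K)
    where
    K⊆all : ∀ {Ms} → All (IsMaximal G) Ms → All (P ⊆_) Ms → All (K ⊆_) Ms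
    K⊆all []                 []           = []
    K⊆all (maxM′ ∷ maximal′) (P⊆M′ ∷ P⊆Ms) = K⊆maximals _ maxM′ P⊆M′ ∷ K⊆all maximal′ P⊆Ms

  InX⇒IsHull : ∀ {K P} → InX G K P → IsHull P K
  InX⇒IsHull {K} {P} (inj₁ (K∈𝓘 , P⊆K , minimal)) = P⊆K , K⊆maximals
    where
    K⊆maximals : ∀ M → IsMaximal G M → P ⊆ M → K ⊆ M
    K⊆maximals M maxM P⊆M = decidable-stable (K ⊆? M) λ K⊈M →
      minimal (M ∩ K) (InI-∩ maxM K∈𝓘) (p⊈q⇒q∩p⊂p K⊈M) (λ x∈P → x∈p∩q⁺ (P⊆M x∈P , P⊆K x∈P))
  InX⇒IsHull (inj₂ (refl , genP , _)) =
    ⊆⊤ , λ M maxM P⊆M → ⊥-elim (⊆-maximal⇒¬Generates maxM P⊆M genP)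

  hull-in-𝓘 : ∀ {P K} → Acc _⊂_ K → InI G K → P ⊆ K → ∃ λ K′ → InI G K′ × IsHull P K′
  hull-in-𝓘 {P} {K} (acc rec) K∈𝓘 P⊆K
    with anySubset? (λ M → IsMaximal? M ×-dec P ⊆? M ×-dec ¬? (K ⊆? M))
  ... | yes (M , maxM , P⊆M , K⊈M) =
    hull-in-𝓘 (rec (p⊈q⇒q∩p⊂p K⊈M)) (InI-∩ maxM K∈𝓘) (λ x∈P → x∈p∩q⁺ (P⊆M x∈P , P⊆K x∈P))
  ... | no ¬escape = K , K∈𝓘 , P⊆K , λ M maxM P⊆M →
    decidable-stable (K ⊆? M) (λ K⊈M → ¬escape (M , maxM , P⊆M , K⊈M))

  ¬Generates⇒hull-in-𝓘 : ∀ {P} → ¬ Generates G P → ∃ λ K → InI G K × IsHull P K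
  ¬Generates⇒hull-in-𝓘 {P} ¬genP with Generates⊎⊆Maximal P
  ... | inj₁ genP = ⊥-elim (¬genP genP)
  ... | inj₂ (M , maxM , P⊆M) = hull-in-𝓘 (⊂-wellFounded M) (IsMaximal⇒InI maxM) P⊆M

  deficiency-suc⇒≢⊤ : ∀ {S m} → Deficiency G S (suc m) → S ≢ ⊤
  deficiency-suc⇒≢⊤ (_ , minimal) refl
    with ≤-trans (minimal ⊥ (Generates-mono (p⊆p∪q ⊥) ⊤-generates)) (≤-reflexive (∣⊥∣≡0 ∣G∣))
  ... | ()

  module _ {I : Subset ∣G∣} {m : ℕ} (δI≡1+m : Deficiency G I (suc m)) where

    deficiency-∪⁅⁆-lower : ∀ g Q → Generates G ((I ∪ ⁅ g ⁆) ∪ Q) → m ≤ ∣ Q ∣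
    deficiency-∪⁅⁆-lower g Q gen
      with ≤-trans (proj₂ δI≡1+m (Q ∪ ⁅ g ⁆) (subst (Generates G) regroup gen)) (∣p∪⁅x⁆∣≤1+∣p∣ Q g)
      where
      regroup : (I ∪ ⁅ g ⁆) ∪ Q ≡ I ∪ (Q ∪ ⁅ g ⁆)
      regroup = trans (∪-assoc I ⁅ g ⁆ Q) (cong (I ∪_) (∪-comm ⁅ g ⁆ Q))
    ... | s≤s m≤∣Q∣ = m≤∣Q∣

    deficiency-∪⁅⁆ : ∀ g → Deficiency G (I ∪ ⁅ g ⁆) (suc m) ⊎ Deficiency G (I ∪ ⁅ g ⁆) m
    deficiency-∪⁅⁆ g
      with anySubset? (λ Q → Generates? ((I ∪ ⁅ g ⁆) ∪ Q) ×-dec ∣ Q ∣ ≤? m)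
    ... | yes (Q , gen , ∣Q∣≤m) =
      inj₂ ((Q , ≤-antisym ∣Q∣≤m (deficiency-∪⁅⁆-lower g Q gen) , gen) , deficiency-∪⁅⁆-lower g)
    ... | no ¬small =
      let Q , ∣Q∣≡1+m , genI∪Q = proj₁ δI≡1+m in
      inj₁ ((Q , ∣Q∣≡1+m , Generates-mono (∪-monoˡ-⊆ Q (p⊆p∪q ⁅ g ⁆)) genI∪Q) ,
            λ Q′ gen′ → ≰⇒> (λ ∣Q′∣≤m → ¬small (Q′ , gen′ , ∣Q′∣≤m)))

    -- Any element g of a smallest completion Q of I lies outside I, and Q - g completes I ∪ {g}.
    deficiency-∪⁅⁆-drops : ∃ λ g → g ∉ I × Deficiency G (I ∪ ⁅ g ⁆) m
    deficiency-∪⁅⁆-drops with proj₁ δI≡1+m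
    ... | Q , ∣Q∣≡1+m , genI∪Q with ∣p∣≡0⊎Nonempty Q
    ...   | inj₁ ∣Q∣≡0 = ⊥-elim (0≢1+n (trans (sym ∣Q∣≡0) ∣Q∣≡1+m))
    ...   | inj₂ (g , g∈Q) = g , g∉I , (Q - g , ∣Q-g∣≡m , gen) , deficiency-∪⁅⁆-lower g
      where
      ∣Q-g∣≡m : ∣ Q - g ∣ ≡ m
      ∣Q-g∣≡m = suc-injective (trans (∣p-x∣+1≡∣p∣ Q g∈Q) ∣Q∣≡1+m)
      gen : Generates G ((I ∪ ⁅ g ⁆) ∪ (Q - g))
      gen = Generates-mono (p∪q⊆[p∪⁅x⁆]∪[q-x] I Q g) genI∪Q
      g∉I : g ∉ I
      g∉I g∈I = <-irrefl (sym ∣Q-g∣≡m) (proj₂ δI≡1+m (Q - g) (Generates-mono I∪⁅g⁆∪Q-g⊆I∪Q-g gen))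
        where
        I∪⁅g⁆∪Q-g⊆I∪Q-g : (I ∪ ⁅ g ⁆) ∪ (Q - g) ⊆ I ∪ (Q - g)
        I∪⁅g⁆∪Q-g⊆I∪Q-g =
          ∪-monoˡ-⊆ (Q - g) (∪-lub id λ x∈⁅g⁆ → subst (_∈ I) (sym (x∈⁅y⁆⇒x≡y g x∈⁅g⁆)) g∈I)

  InX⇒InIG : ∀ {K P} → InX G K P → InIG G K
  InX⇒InIG (inj₁ (K∈𝓘 , _)) = inj₁ K∈𝓘
  InX⇒InIG (inj₂ (K≡⊤ , _)) = inj₂ K≡⊤

  InX⇒InE : ∀ {I P K d} → IsSubgroup G I → 2 ∣ ∣ I ∣ → I ⊆ P →
    InX G K P → Deficiency G P d → InE G d K
  InX⇒InE I≤G 2∣∣I∣ I⊆P P∈X_K δP≡d =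
    K∈𝓘∪G , even-subgroup⇒even-supergroup I≤G 2∣∣I∣ (InIG⇒IsSubgroup K∈𝓘∪G) (proj₁ hull ∘ I⊆P) ,
    hull-deficiency hull δP≡d
    where
    K∈𝓘∪G = InX⇒InIG P∈X_K
    hull = InX⇒IsHull P∈X_K

  InX-∪⁅⁆-exists : ∀ {I} → ¬ Generates G I → ∀ g → ∃ λ K → InX G K (I ∪ ⁅ g ⁆)
  InX-∪⁅⁆-exists {I} ¬genI g with Generates? (I ∪ ⁅ g ⁆)
  ... | yes genP = ⊤ , inj₂ (refl , genP , g , q⊆p∪q I ⁅ g ⁆ (x∈⁅x⁆ g) ,
                             ¬genI ∘ Generates-mono ([p∪⁅x⁆]-x⊆p I))
  ... | no ¬genP =
    let K , K∈𝓘 , hull = ¬Generates⇒hull-in-𝓘 ¬genP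
    in K , inj₁ (K∈𝓘 , proj₁ hull , IsHull⇒minimal hull)

corollary3p9 : (G : FiniteGroup) (m : ℕ) (I : Subset (FiniteGroup.n G)) →
    InE G (suc m) I →
    (Σ (Subset (FiniteGroup.n G)) λ K → Option G I K × InE G m K)
    × (∀ K → Option G I K → InE G (suc m) K ⊎ InE G m K)
corollary3p9 G m I (I∈𝓘∪G , 2∣∣I∣ , δI≡1+m) = option-in-𝓔ₘ , options-in-𝓔
  where
  I∈𝓘 : InI G I
  I∈𝓘 = [ id , ⊥-elim ∘ deficiency-suc⇒≢⊤ G δI≡1+m ] I∈𝓘∪G

  option-in-𝓔 : ∀ {K d} g → InX G K (I ∪ ⁅ g ⁆) → Deficiency G (I ∪ ⁅ g ⁆) d → InE G d K
  option-in-𝓔 g = InX⇒InE G (InI⇒IsSubgroup G I∈𝓘) 2∣∣I∣ (p⊆p∪q ⁅ g ⁆)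

  option-in-𝓔ₘ : Σ (Subset (FiniteGroup.n G)) λ K → Option G I K × InE G m K
  option-in-𝓔ₘ =
    let g , g∉I , δP≡m = deficiency-∪⁅⁆-drops G δI≡1+m
        K , P∈X_K      = InX-∪⁅⁆-exists G (InI⇒¬Generates G I∈𝓘) g
    in K , (g , g∉I , P∈X_K) , option-in-𝓔 g P∈X_K δP≡m

  options-in-𝓔 : ∀ K → Option G I K → InE G (suc m) K ⊎ InE G m K
  options-in-𝓔 K (g , _ , P∈X_K) =
    Sum.map (option-in-𝓔 g P∈X_K) (option-in-𝓔 g P∈X_K) (deficiency-∪⁅⁆ G δI≡1+m g)
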